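{- For $h\in\mathbb{N}$, let $\mathcal{C}_h := \{C\langle h,k\rangle : k\in\mathbb{N}\}$. Then $\chi^f_{\Delta}(\mathcal{C}_h) \ge h$.
   Context: All graphs are finite and simple. Trees and closures. The depth of a rooted tree is the maximum number of vertices on a root-to-leaf path. The closure of a rooted tree $T$ is obtained by adding an edge between every vertex and each of its descendants. $C\langle h,k\rangle$ is the closure of the complete $k$-ary tree of depth $h$. Fractional defective colourings. For real $t\ge 1$, a graph $G$ is fractionally $t$-colourable with defect $d$ if there exist $Y_1,\dots,Y_s\subseteq V(G)$ and $\alpha_1,\dots,\alpha_s\in[0,1]$ such that: - each $G[Y_i]$ has maximum degree at most $d$; - $\sum_i\alpha_i\le t$; - $\sum_{i: v\in Y_i}\alpha_i\ge 1$ for every vertex $v$. For a graph class $\mathcal{G}$, $\chi^f_{\Delta}(\mathcal{G})$ is the infimum of $t>0$ such that there exists $d$ with every graph in $\mathcal{G}$ fractionally $t$-colourable with defect $d$.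
   Formalization: The parameter t and the weights $\alpha_i$ of the fractional colourings are rational numbers rather than reals. -}

module Defs where

open import Level using (0ℓ)
open import Data.Nat using (ℕ; zero; suc; _<_)
import Data.Nat as ℕ
open import Data.Fin using (Fin; zero; suc)
open import Data.Bool using (Bool; true; false; if_then_else_)
open import Data.List using (List; []; _++_; length)
open import Data.List.Relation.Unary.All using (All)
open import Data.List.Relation.Unary.Unique.Propositional using (Unique)
open import Data.Product using (Σ; _×_; _,_; proj₁; ∃)
open import Data.Sum using (_⊎_)
open import Data.Rational using (ℚ; 0ℚ; 1ℚ; _+_; _≤_; _<_)
open import Relation.Binary.PropositionalEquality using (_≡_; _≢_)

record Graph : Set₁ where
  field
    V   : Set
    Adj : V → V → Set
open Graph public

ProperPrefix : {A : Set} → List A → List A → Set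
ProperPrefix u v = Σ _ λ ys → (ys ≢ []) × (u ++ ys ≡ v)

-- Closure of the complete k-ary tree of depth h:
-- vertices = words over Fin k of length < h (the root is the empty word,
-- so root-to-leaf paths have h vertices); u ~ v iff one is a proper
-- ancestor (proper prefix) of the other.
C⟨_,_⟩ : ℕ → ℕ → Graph
C⟨ h , k ⟩ = record
  { V   = Σ (List (Fin k)) (λ w → length w ℕ.< h)
  ; Adj = λ u v → ProperPrefix (proj₁ u) (proj₁ v) ⊎ ProperPrefix (proj₁ v) (proj₁ u)
  }

MaxDegInduced≤ : (G : Graph) → (V G → Bool) → ℕ → Set
MaxDegInduced≤ G Y d =
  ∀ (v : V G) → Y v ≡ true →
  ∀ (ws : List (V G)) → Unique ws →
  All (λ w → (Y w ≡ true) × Adj G v w) ws → length ws ℕ.≤ d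

sumFin : (s : ℕ) → (Fin s → ℚ) → ℚ
sumFin zero    f = 0ℚ
sumFin (suc s) f = f zero + sumFin s (λ i → f (suc i))

FracColourable : (G : Graph) → ℚ → ℕ → Set
FracColourable G t d =
  Σ ℕ λ s → Σ (Fin s → (V G → Bool)) λ Y → Σ (Fin s → ℚ) λ α →
    (∀ i → (0ℚ ≤ α i) × (α i ≤ 1ℚ)) ×
    (∀ i → MaxDegInduced≤ G (Y i) d) ×
    (sumFin s α ≤ t) ×
    (∀ (v : V G) → 1ℚ ≤ sumFin s (λ i → if Y i v then α i else 0ℚ))

{-# OPTIONS --safe #-}
module Submission where

-- Given a fractional colouring of C⟨h,K⟩ with defect d and total weight T, some root-to-leaf branch
-- has total coverage S with K·S ≤ (K + h·d)·T. By induction on h: the classes containing the root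
-- are charged to the root and the others are passed on to the K subtrees. The branches found in the
-- subtrees all lie in the neighbourhood of the root, so each class containing the root meets their
-- union in at most d vertices; descending into the child whose branch meets these classes least
-- costs at most d/K times their weight. As the h vertices of the branch have coverage at least 1,
-- K·h ≤ (K + h·d)·t, which fails for large K once t < h.

open import Level using (0ℓ)
open import Algebra.Bundles using (Semiring; CommutativeRing)
open import Data.Nat as ℕ using (ℕ; zero; suc; z≤n; s≤s)
open import Data.Nat.Coprimality using (Coprime)
open import Data.Fin using (Fin; zero; suc)
open import Data.Bool using (Bool; true; false; if_then_else_)
open import Data.Bool.Properties using (T-≡)
open import Data.List using (List; []; _∷_; _++_; length; lookup; map; concat; tabulate; filterᵇ)
import Data.List.Properties as List
open import Data.List.Relation.Unary.All as All using (All)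
import Data.List.Relation.Unary.All.Properties as Allₚ
open import Data.List.Relation.Unary.AllPairs using ([]; _∷_)
import Data.List.Relation.Unary.AllPairs.Properties as AllPairsₚ
open import Data.List.Relation.Unary.Unique.Propositional using (Unique)
import Data.List.Relation.Unary.Unique.Propositional.Properties as Uniqueₚ
open import Data.List.Relation.Binary.Disjoint.Propositional using (Disjoint)
open import Data.List.Membership.Propositional.Properties using (∈-map⁻)
open import Data.Product as Product using (_×_; _,_; proj₁; proj₂; ∃; ∃-syntax)
open import Data.Sum as Sum using (inj₁; inj₂)
open import Data.Rational using (ℚ; mkℚ; 0ℚ; 1ℚ; _+_; _*_; _-_; -_; _≤_; _<_; _/_; *<*; toℚᵘ; nonNegative)
open import Data.Rational.Properties
open import Data.Rational.Solver using (module +-*-Solver)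
import Data.Integer as ℤ
import Data.Integer.Properties as ℤ
import Data.Integer.Solver as ℤ-Solver
import Data.Rational.Unnormalised as ℚᵘ
import Data.Rational.Unnormalised.Properties as ℚᵘ
open import Function using (_∘_; Equivalence)
open import Relation.Binary.PropositionalEquality
open import Relation.Nullary using (¬_)
open import Relation.Nullary.Decidable using (T?)
open import Defs

ℚ-semiring : Semiring 0ℓ 0ℓ
ℚ-semiring = CommutativeRing.semiring +-*-commutativeRing

open import Algebra.Properties.Semiring.Sum ℚ-semiring
open import Algebra.Properties.Semiring.Mult ℚ-semiring
  using (×1-homo-*; ×-assoc-*) renaming (_×_ to _·_)

fromℕ : ℕ → ℚ
fromℕ n = n · 1ℚ

0<1 : 0ℚ < 1ℚ
0<1 = *<* (ℤ.+<+ (s≤s z≤n))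

fromℕ-nonNeg : ∀ n → 0ℚ ≤ fromℕ n
fromℕ-nonNeg zero    = ≤-refl
fromℕ-nonNeg (suc n) = +-mono-≤ (<⇒≤ 0<1) (fromℕ-nonNeg n)

fromℕ-mono-≤ : ∀ {m n} → m ℕ.≤ n → fromℕ m ≤ fromℕ n
fromℕ-mono-≤ {n = n} z≤n = fromℕ-nonNeg n
fromℕ-mono-≤ (s≤s m≤n)   = +-monoʳ-≤ 1ℚ (fromℕ-mono-≤ m≤n)

fromℕ-<-suc : ∀ n → fromℕ n < fromℕ (suc n)
fromℕ-<-suc n = subst (_< fromℕ (suc n)) (+-identityˡ (fromℕ n)) (+-monoˡ-< (fromℕ n) 0<1)

nonNeg-* : ∀ {p q} → 0ℚ ≤ p → 0ℚ ≤ q → 0ℚ ≤ p * q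
nonNeg-* {p} {q} p≥0 q≥0 = subst (_≤ p * q) (*-zeroʳ p) (*-monoˡ-≤-nonNeg p {{nonNegative p≥0}} q≥0)

sumFin≡sum : ∀ s (f : Fin s → ℚ) → sumFin s f ≡ sum f
sumFin≡sum zero    f = refl
sumFin≡sum (suc s) f = cong (f zero +_) (sumFin≡sum s (f ∘ suc))

sum-mono-≤ : ∀ {n} {f g : Fin n → ℚ} → (∀ i → f i ≤ g i) → sum f ≤ sum g
sum-mono-≤ {zero}  f≤g = ≤-refl
sum-mono-≤ {suc n} f≤g = +-mono-≤ (f≤g zero) (sum-mono-≤ (f≤g ∘ suc))

sum-nonNeg : ∀ {n} {f : Fin n → ℚ} → (∀ i → 0ℚ ≤ f i) → 0ℚ ≤ sum f
sum-nonNeg {n} {f} f≥0 = subst (_≤ sum f) (sum-replicate-zero n) (sum-mono-≤ f≥0)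

sum-const : ∀ n x → sum {n} (λ _ → x) ≡ fromℕ n * x
sum-const n x = trans (sum-replicate n) (sym (trans (×-assoc-* n 1ℚ x) (cong (n ·_) (*-identityˡ x))))

∃-minimum : ∀ n (f : Fin (suc n) → ℚ) → ∃[ c ] (∀ j → f c ≤ f j)
∃-minimum zero    f = zero , λ { zero → ≤-refl }
∃-minimum (suc n) f with ∃-minimum n (f ∘ suc)
... | c , min with ≤-total (f zero) (f (suc c))
...   | inj₁ f₀≤ = zero , λ { zero → ≤-refl ; (suc j) → ≤-trans f₀≤ (min j) }
...   | inj₂ ≤f₀ = suc c , λ { zero → ≤f₀ ; (suc j) → min j }

∃-mean≤ : ∀ n (f : Fin (suc n) → ℚ) → ∃[ c ] fromℕ (suc n) * f c ≤ sum f
∃-mean≤ n f =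
  let c , min = ∃-minimum n f
  in  c , subst (_≤ sum f) (sum-const (suc n) (f c)) (sum-mono-≤ min)

∑ₗ : {A : Set} → (A → ℚ) → List A → ℚ
∑ₗ f xs = ∑[ j < length xs ] f (lookup xs j)

module _ {A : Set} where

  ∑ₗ-++ : (f : A → ℚ) (xs ys : List A) → ∑ₗ f (xs ++ ys) ≡ ∑ₗ f xs + ∑ₗ f ys
  ∑ₗ-++ f []       ys = sym (+-identityˡ _)
  ∑ₗ-++ f (x ∷ xs) ys = trans (cong (f x +_) (∑ₗ-++ f xs ys)) (sym (+-assoc (f x) _ _))

  ∑ₗ-concat : (f : A → ℚ) (xss : List (List A)) → ∑ₗ f (concat xss) ≡ ∑ₗ (∑ₗ f) xss
  ∑ₗ-concat f []         = refl
  ∑ₗ-concat f (xs ∷ xss) = trans (∑ₗ-++ f xs (concat xss)) (cong (∑ₗ f xs +_) (∑ₗ-concat f xss))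

  ∑ₗ-tabulate : ∀ {n} (f : A → ℚ) (F : Fin n → A) → ∑ₗ f (tabulate F) ≡ ∑[ i < n ] f (F i)
  ∑ₗ-tabulate {zero}  f F = refl
  ∑ₗ-tabulate {suc n} f F = cong (f (F zero) +_) (∑ₗ-tabulate f (F ∘ suc))

  ∑ₗ-map : {B : Set} (f : B → ℚ) (g : A → B) (xs : List A) → ∑ₗ f (map g xs) ≡ ∑ₗ (f ∘ g) xs
  ∑ₗ-map f g []       = refl
  ∑ₗ-map f g (x ∷ xs) = cong (f (g x) +_) (∑ₗ-map f g xs)

  ∑ₗ-mono-≤ : {f g : A → ℚ} → (∀ x → f x ≤ g x) → (xs : List A) → ∑ₗ f xs ≤ ∑ₗ g xs
  ∑ₗ-mono-≤ f≤g xs = sum-mono-≤ (f≤g ∘ lookup xs)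

  ∑ₗ-const : (x : ℚ) (xs : List A) → ∑ₗ (λ _ → x) xs ≡ fromℕ (length xs) * x
  ∑ₗ-const x xs = sum-const (length xs) x

  ∑ₗ-if : (Y : A → Bool) (x : ℚ) (xs : List A) →
          ∑ₗ (λ u → if Y u then x else 0ℚ) xs ≡ fromℕ (length (filterᵇ Y xs)) * x
  ∑ₗ-if Y x xs = trans (filter-indicator xs) (∑ₗ-const x (filterᵇ Y xs))
    where
    filter-indicator : ∀ xs → ∑ₗ (λ u → if Y u then x else 0ℚ) xs ≡ ∑ₗ (λ _ → x) (filterᵇ Y xs)
    filter-indicator []       = refl
    filter-indicator (u ∷ us) with Y u
    ... | true  = cong (x +_) (filter-indicator us)
    ... | false = trans (+-identityˡ _) (filter-indicator us)

coverage : {A : Set} {s : ℕ} → (Fin s → A → Bool) → (Fin s → ℚ) → A → ℚ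
coverage {s = s} Y α v = ∑[ i < s ] (if Y i v then α i else 0ℚ)

coverage-+ : ∀ {A : Set} {s} (Y : Fin s → A → Bool) {α β γ : Fin s → ℚ} →
             (∀ i → α i ≡ β i + γ i) → ∀ v → coverage Y α v ≡ coverage Y β v + coverage Y γ v
coverage-+ Y {β = β} {γ} α≡β+γ v =
  trans (sum-cong-≗ (λ i → if-+ (Y i v) (α≡β+γ i)))
        (∑-distrib-+ (λ i → if Y i v then β i else 0ℚ) (λ i → if Y i v then γ i else 0ℚ))
  where
  if-+ : ∀ b {x y z} → x ≡ y + z → (if b then x else 0ℚ) ≡ (if b then y else 0ℚ) + (if b then z else 0ℚ)
  if-+ true  x≡y+z = x≡y+z
  if-+ false _     = refl

if-nonNeg : ∀ b {x y} → 0ℚ ≤ x → 0ℚ ≤ y → 0ℚ ≤ (if b then x else y)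
if-nonNeg true  x≥0 _   = x≥0
if-nonNeg false _   y≥0 = y≥0

coverage-nonNeg : ∀ {A : Set} {s} (Y : Fin s → A → Bool) {α : Fin s → ℚ} → (∀ i → 0ℚ ≤ α i) →
                  ∀ v → 0ℚ ≤ coverage Y α v
coverage-nonNeg Y α≥0 v = sum-nonNeg (λ i → if-nonNeg (Y i v) (α≥0 i) ≤-refl)

∑ₗ-coverage-map : ∀ {A B : Set} {s} (Y : Fin s → A → Bool) {α β γ : Fin s → ℚ} →
                  (∀ i → α i ≡ β i + γ i) → (f : B → A) (xs : List B) →
                  ∑ₗ (coverage Y α) (map f xs)
                    ≡ ∑ₗ (coverage Y β) (map f xs) + ∑ₗ (coverage (λ i → Y i ∘ f) γ) xs
∑ₗ-coverage-map Y {α} {β} {γ} α≡β+γ f xs = begin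
  ∑ₗ (coverage Y α) (map f xs)
    ≡⟨ ∑ₗ-map (coverage Y α) f xs ⟩
  ∑ₗ (coverage Y α ∘ f) xs
    ≡⟨ sum-cong-≗ (coverage-+ Y α≡β+γ ∘ f ∘ lookup xs) ⟩
  ∑ₗ (λ v → coverage Y β (f v) + coverage Y γ (f v)) xs
    ≡⟨ ∑-distrib-+ (coverage Y β ∘ f ∘ lookup xs) (coverage Y γ ∘ f ∘ lookup xs) ⟩
  ∑ₗ (coverage Y β ∘ f) xs + ∑ₗ (coverage Y γ ∘ f) xs
    ≡⟨ cong (_+ ∑ₗ (coverage Y γ ∘ f) xs) (∑ₗ-map (coverage Y β) f xs) ⟨
  ∑ₗ (coverage Y β) (map f xs) + ∑ₗ (coverage (λ i → Y i ∘ f) γ) xs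
    ∎
  where open ≡-Reasoning

module _ {G : Graph} {d : ℕ} where

  count-neighbours≤ : ∀ {Y} → MaxDegInduced≤ G Y d → ∀ {v M} → Y v ≡ true → Unique M → All (Adj G v) M →
                      length (filterᵇ Y M) ℕ.≤ d
  count-neighbours≤ {Y} deg {v} {M} Yv M-unique M-adj =
    deg v Yv (filterᵇ Y M) (Uniqueₚ.filter⁺ (T? ∘ Y) M-unique)
      (All.zip ( All.map (Equivalence.to T-≡) (Allₚ.all-filter (T? ∘ Y) M)
               , Allₚ.filter⁺ (T? ∘ Y) M-adj))

  neighbourhood-weight≤ : ∀ {Y} → MaxDegInduced≤ G Y d → ∀ {v M} → Unique M → All (Adj G v) M →
                          ∀ {x} → 0ℚ ≤ x →
                          ∑ₗ (λ u → if Y u then (if Y v then x else 0ℚ) else 0ℚ) M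
                            ≤ fromℕ d * (if Y v then x else 0ℚ)
  neighbourhood-weight≤ {Y} deg {v} {M} M-unique M-adj {x} x≥0 with Y v in Yv
  ... | true  = begin
    ∑ₗ (λ u → if Y u then x else 0ℚ) M  ≡⟨ ∑ₗ-if Y x M ⟩
    fromℕ (length (filterᵇ Y M)) * x    ≤⟨ *-monoʳ-≤-nonNeg x {{nonNegative x≥0}}
                                             (fromℕ-mono-≤ (count-neighbours≤ deg Yv M-unique M-adj)) ⟩
    fromℕ d * x                         ∎
    where open ≤-Reasoning
  ... | false = ≤-reflexive (trans (∑ₗ-if Y 0ℚ M)
                                  (trans (*-zeroʳ (fromℕ (length (filterᵇ Y M)))) (sym (*-zeroʳ (fromℕ d)))))

  neighbourhood-coverage≤ : ∀ {s} {Y : Fin s → V G → Bool} {α : Fin s → ℚ} →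
                            (∀ i → MaxDegInduced≤ G (Y i) d) → (∀ i → 0ℚ ≤ α i) →
                            ∀ {v M} → Unique M → All (Adj G v) M →
                            ∑ₗ (coverage Y (λ i → if Y i v then α i else 0ℚ)) M ≤ fromℕ d * coverage Y α v
  neighbourhood-coverage≤ {s} {Y} {α} deg α≥0 {v} {M} M-unique M-adj = begin
    ∑ₗ (coverage Y αᵥ) M
      ≡⟨ ∑-comm (λ j i → if Y i (lookup M j) then αᵥ i else 0ℚ) ⟩
    ∑[ i < s ] ∑ₗ (λ u → if Y i u then αᵥ i else 0ℚ) M
      ≤⟨ sum-mono-≤ (λ i → neighbourhood-weight≤ (deg i) M-unique M-adj (α≥0 i)) ⟩
    ∑[ i < s ] (fromℕ d * αᵥ i)
      ≡⟨ *-distribˡ-sum (fromℕ d) αᵥ ⟨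
    fromℕ d * coverage Y α v
      ∎
    where
    open ≤-Reasoning
    αᵥ : Fin s → ℚ
    αᵥ i = if Y i v then α i else 0ℚ

MaxDegInduced≤-comap : ∀ {G H : Graph} {Y d} (f : V H → V G) → (∀ {u v} → f u ≡ f v → u ≡ v) →
                       (∀ {u v} → Adj H u v → Adj G (f u) (f v)) →
                       MaxDegInduced≤ G Y d → MaxDegInduced≤ H (Y ∘ f) d
MaxDegInduced≤-comap {d = d} f f-injective f-hom deg v Yfv ws ws-unique ws-adj =
  subst (ℕ._≤ d) (List.length-map f ws)
    (deg (f v) Yfv (map f ws) (Uniqueₚ.map⁺ f-injective ws-unique)
      (Allₚ.map⁺ (All.map (Product.map₂ f-hom) ws-adj)))

module _ {h k : ℕ} where

  root : V C⟨ suc h , k ⟩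
  root = [] , s≤s z≤n

  child : Fin k → V C⟨ h , k ⟩ → V C⟨ suc h , k ⟩
  child c (w , |w|<h) = c ∷ w , s≤s |w|<h

  child-injective : ∀ {c u v} → child c u ≡ child c v → u ≡ v
  child-injective {u = _ , _} {_ , _} refl = refl

  child-injectiveˡ : ∀ {c c′ u v} → child c u ≡ child c′ v → c ≡ c′
  child-injectiveˡ {u = _ , _} {_ , _} refl = refl

  root≢child : ∀ c v → root ≢ child c v
  root≢child c (_ , _) ()

  child-adj : ∀ {c u v} → Adj C⟨ h , k ⟩ u v → Adj C⟨ suc h , k ⟩ (child c u) (child c v)
  child-adj {c} = Sum.map prefix-cons prefix-cons
    where
    prefix-cons : ∀ {u w} → ProperPrefix u w → ProperPrefix (c ∷ u) (c ∷ w)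
    prefix-cons (ys , ys≢[] , u++ys≡w) = ys , ys≢[] , cong (c ∷_) u++ys≡w

  root-adj-child : ∀ c v → Adj C⟨ suc h , k ⟩ root (child c v)
  root-adj-child c v = inj₁ (proj₁ (child c v) , (λ ()) , refl)

  childBranches : (Fin k → List (V C⟨ h , k ⟩)) → List (V C⟨ suc h , k ⟩)
  childBranches L = concat (tabulate (λ c → map (child c) (L c)))

  childBranches-unique : ∀ L → (∀ c → Unique (L c)) → Unique (childBranches L)
  childBranches-unique L L-unique =
    Uniqueₚ.concat⁺ (Allₚ.tabulate⁺ (λ c → Uniqueₚ.map⁺ child-injective (L-unique c)))
                    (AllPairsₚ.tabulate⁺ disjoint)
    where
    disjoint : ∀ {c c′} → c ≢ c′ → Disjoint (map (child c) (L c)) (map (child c′) (L c′))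
    disjoint {c} {c′} c≢c′ (u∈ , u∈′) with ∈-map⁻ (child c) u∈ | ∈-map⁻ (child c′) u∈′
    ... | _ , _ , refl | _ , _ , eq = c≢c′ (child-injectiveˡ eq)

  childBranches-adj : ∀ L → All (Adj C⟨ suc h , k ⟩ root) (childBranches L)
  childBranches-adj L =
    Allₚ.concat⁺ (Allₚ.tabulate⁺ (λ c → Allₚ.map⁺ (All.universal (root-adj-child c) (L c))))

  MaxDegInduced≤-child : ∀ {Y d} c → MaxDegInduced≤ C⟨ suc h , k ⟩ Y d →
                         MaxDegInduced≤ C⟨ h , k ⟩ (Y ∘ child c) d
  MaxDegInduced≤-child c = MaxDegInduced≤-comap {G = C⟨ suc h , k ⟩} {H = C⟨ h , k ⟩} (child c) child-injective
                             (λ {u} {v} → child-adj {u = u} {v})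

  childBranches-coverage≤ : ∀ {d s} {Y : Fin s → V C⟨ suc h , k ⟩ → Bool} {α : Fin s → ℚ} →
                            (∀ i → MaxDegInduced≤ C⟨ suc h , k ⟩ (Y i) d) → (∀ i → 0ℚ ≤ α i) →
                            (L : Fin k → List (V C⟨ h , k ⟩)) → (∀ c → Unique (L c)) →
                            ∑[ c < k ] ∑ₗ (coverage Y (λ i → if Y i root then α i else 0ℚ)) (map (child c) (L c))
                              ≤ fromℕ d * coverage Y α root
  childBranches-coverage≤ {d} {s} {Y} {α} deg α≥0 L L-unique =
    subst (_≤ fromℕ d * coverage Y α root)
      (trans (∑ₗ-concat (coverage Y αᵣ) (tabulate branches)) (∑ₗ-tabulate (∑ₗ (coverage Y αᵣ)) branches))
      (neighbourhood-coverage≤ deg α≥0 (childBranches-unique L L-unique) (childBranches-adj L))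
    where
    αᵣ : Fin s → ℚ
    αᵣ i = if Y i root then α i else 0ℚ
    branches : Fin k → List (V C⟨ suc h , k ⟩)
    branches c = map (child c) (L c)

branch-step : ∀ {K h d A B S x} → 0ℚ ≤ h → 0ℚ ≤ d → 0ℚ ≤ A → 0ℚ ≤ B →
              K * S ≤ (K + h * d) * B → K * x ≤ d * A →
              K * (A + (x + S)) ≤ (K + (1ℚ + h) * d) * (A + B)
branch-step {K} {h} {d} {A} {B} {S} {x} h≥0 d≥0 A≥0 B≥0 KS≤ Kx≤ = begin
  K * (A + (x + S))                                      ≡⟨ expand K A x S ⟩
  K * A + K * x + K * S                                  ≤⟨ +-mono-≤ (+-monoʳ-≤ (K * A) Kx≤) KS≤ ⟩
  K * A + d * A + (K + h * d) * B                        ≤⟨ p≤p+q (+-mono-≤ (nonNeg-* (nonNeg-* h≥0 d≥0) A≥0)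
                                                                              (nonNeg-* d≥0 B≥0)) ⟩
  K * A + d * A + (K + h * d) * B + (h * d * A + d * B)  ≡⟨ collect K h d A B ⟩
  (K + (1ℚ + h) * d) * (A + B)                           ∎
  where
  open ≤-Reasoning
  open +-*-Solver
  p≤p+q : ∀ {p q} → 0ℚ ≤ q → p ≤ p + q
  p≤p+q {p} {q} q≥0 = subst (_≤ p + q) (+-identityʳ p) (+-monoʳ-≤ p q≥0)
  expand : ∀ K A x S → K * (A + (x + S)) ≡ K * A + K * x + K * S
  expand = solve 4 (λ K A x S → K :* (A :+ (x :+ S)) := K :* A :+ K :* x :+ K :* S) refl
  collect : ∀ K h d A B → K * A + d * A + (K + h * d) * B + (h * d * A + d * B) ≡ (K + (1ℚ + h) * d) * (A + B)
  collect = solve 5 (λ K h d A B → K :* A :+ d :* A :+ (K :+ h :* d) :* B :+ (h :* d :* A :+ d :* B)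
                                   := (K :+ (con 1ℚ :+ h) :* d) :* (A :+ B)) refl

∃-light-branch : ∀ {k} d h {s} (Y : Fin s → V C⟨ h , suc k ⟩ → Bool) (α : Fin s → ℚ) →
                 (∀ i → 0ℚ ≤ α i) → (∀ i → MaxDegInduced≤ C⟨ h , suc k ⟩ (Y i) d) →
                 ∃[ L ] Unique L × length L ≡ h ×
                   fromℕ (suc k) * ∑ₗ (coverage Y α) L ≤ (fromℕ (suc k) + fromℕ h * fromℕ d) * sum α
∃-light-branch {k} d zero Y α α≥0 deg =
  [] , [] , refl ,
  ≤-trans (≤-reflexive (*-zeroʳ (fromℕ (suc k))))
          (nonNeg-* (+-mono-≤ (fromℕ-nonNeg (suc k)) (nonNeg-* ≤-refl (fromℕ-nonNeg d))) (sum-nonNeg α≥0))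
∃-light-branch {k} d (suc h) {s} Y α α≥0 deg =
  root ∷ map (child c) (L c) , branch-unique , branch-length , branch-bound
  where
  K A : ℚ
  K = fromℕ (suc k)
  A = coverage Y α root

  a β : Fin s → ℚ
  a i = if Y i root then α i else 0ℚ
  β i = if Y i root then 0ℚ else α i

  α≡a+β : ∀ i → α i ≡ a i + β i
  α≡a+β i with Y i root
  ... | true  = sym (+-identityʳ (α i))
  ... | false = sym (+-identityˡ (α i))

  β≥0 : ∀ i → 0ℚ ≤ β i
  β≥0 i = if-nonNeg (Y i root) ≤-refl (α≥0 i)

  subtree : ∀ c → ∃[ L ] Unique L × length L ≡ h ×
                    K * ∑ₗ (coverage (λ i → Y i ∘ child c) β) L ≤ (K + fromℕ h * fromℕ d) * sum β
  subtree c = ∃-light-branch d h (λ i → Y i ∘ child c) β β≥0 (λ i → MaxDegInduced≤-child c (deg i))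

  L : Fin (suc k) → List (V C⟨ h , suc k ⟩)
  L c = proj₁ (subtree c)

  x : Fin (suc k) → ℚ
  x c = ∑ₗ (coverage Y a) (map (child c) (L c))

  c : Fin (suc k)
  c = proj₁ (∃-mean≤ k x)

  S : ℚ
  S = ∑ₗ (coverage (λ i → Y i ∘ child c) β) (L c)

  branch-unique : Unique (root ∷ map (child c) (L c))
  branch-unique = Allₚ.map⁺ (All.universal (root≢child c) (L c))
                ∷ Uniqueₚ.map⁺ child-injective (proj₁ (proj₂ (subtree c)))

  branch-length : length (root ∷ map (child c) (L c)) ≡ suc h
  branch-length = cong suc (trans (List.length-map (child c) (L c)) (proj₁ (proj₂ (proj₂ (subtree c)))))

  branch-bound : K * ∑ₗ (coverage Y α) (root ∷ map (child c) (L c)) ≤ (K + fromℕ (suc h) * fromℕ d) * sum α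
  branch-bound = begin
    K * (A + ∑ₗ (coverage Y α) (map (child c) (L c)))
      ≡⟨ cong (λ z → K * (A + z)) (∑ₗ-coverage-map Y α≡a+β (child c) (L c)) ⟩
    K * (A + (x c + S))
      ≤⟨ branch-step {K} {S = S} {x c} (fromℕ-nonNeg h) (fromℕ-nonNeg d)
           (coverage-nonNeg Y α≥0 root) (sum-nonNeg β≥0)
           (proj₂ (proj₂ (proj₂ (subtree c))))
           (≤-trans (proj₂ (∃-mean≤ k x)) (childBranches-coverage≤ deg α≥0 L (proj₁ ∘ proj₂ ∘ subtree))) ⟩
    (K + fromℕ (suc h) * fromℕ d) * (A + sum β)
      ≡⟨ cong ((K + fromℕ (suc h) * fromℕ d) *_) (trans (sum-cong-≗ α≡a+β) (∑-distrib-+ a β)) ⟨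
    (K + fromℕ (suc h) * fromℕ d) * sum α
      ∎
    where open ≤-Reasoning

-- Opened only here: the constructor +_ would make the sections (x +_) above ambiguous.
open import Data.Integer using (+_; +[1+_]; +0; -[1+_])

toℚᵘ-fromℕ : ∀ n → toℚᵘ (fromℕ n) ℚᵘ.≃ ℚᵘ.mkℚᵘ (+ n) 0
toℚᵘ-fromℕ zero    = ℚᵘ.≃-refl
toℚᵘ-fromℕ (suc n) =
  ℚᵘ.≃-trans (toℚᵘ-homo-+ 1ℚ (fromℕ n))
    (ℚᵘ.≃-trans (ℚᵘ.+-congʳ (toℚᵘ 1ℚ) (toℚᵘ-fromℕ n))
      (ℚᵘ.*≡* (trans (ℤ.*-identityʳ _)
                (trans (cong (ℤ._+_ (+ 1)) (ℤ.*-identityʳ (+ n))) (sym (ℤ.*-identityʳ (+ suc n)))))))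

fromℕ≡/1 : ∀ n → fromℕ n ≡ + n / 1
fromℕ≡/1 n = trans (sym (fromℚᵘ-toℚᵘ (fromℕ n))) (fromℚᵘ-cong (toℚᵘ-fromℕ n))

denominator-*-cancel : ∀ a b .(c : Coprime (suc a) (suc b)) → fromℕ (suc b) * mkℚ +[1+ a ] b c ≡ fromℕ (suc a)
denominator-*-cancel a b c =
  toℚᵘ-injective (ℚᵘ.≃-trans (toℚᵘ-homo-* (fromℕ (suc b)) (mkℚ +[1+ a ] b c))
    (ℚᵘ.≃-trans (ℚᵘ.*-congʳ (toℚᵘ-fromℕ (suc b)))
      (ℚᵘ.≃-trans (ℚᵘ.*≡* (cancel (+ suc b) (+ suc a))) (ℚᵘ.≃-sym (toℚᵘ-fromℕ (suc a))))))
  where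
  open ℤ-Solver.+-*-Solver
  cancel : ∀ x y → (x ℤ.* y) ℤ.* + 1 ≡ y ℤ.* (+ 1 ℤ.* x)
  cancel = solve 2 (λ x y → (x :* y) :* con (+ 1) := y :* (con (+ 1) :* x)) refl

archimedean : ∀ {ε} → 0ℚ < ε → ∃[ n ] 1ℚ ≤ fromℕ (suc n) * ε
archimedean {mkℚ +[1+ a ] b c} _ =
  b , ≤-trans (fromℕ-mono-≤ {1} {suc a} (s≤s z≤n)) (≤-reflexive (sym (denominator-*-cancel a b c)))
archimedean {mkℚ +0       _ _} (*<* (ℤ.+<+ ()))
archimedean {mkℚ -[1+ _ ] _ _} (*<* ())

∃-large-branching : ∀ h d {t} → t < fromℕ h →
                    ∃[ k ] (fromℕ (suc k) + fromℕ h * fromℕ d) * t < fromℕ (suc k) * fromℕ h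
∃-large-branching h d {t} t<h = k , (begin-strict
  (K + fromℕ h * fromℕ d) * t     ≡⟨ *-distribʳ-+ t K (fromℕ h * fromℕ d) ⟩
  K * t + fromℕ h * fromℕ d * t   ≤⟨ +-monoʳ-≤ (K * t) hdt≤N ⟩
  K * t + fromℕ N                 <⟨ +-monoʳ-< (K * t) (fromℕ-<-suc N) ⟩
  K * t + fromℕ (suc N)           ≤⟨ +-monoʳ-≤ (K * t) 1+N≤Kε ⟩
  K * t + K * ε                   ≡⟨ t+ε≡h K t (fromℕ h) ⟩
  K * fromℕ h                     ∎)
  where
  open ≤-Reasoning
  ε : ℚ
  ε = fromℕ h - t
  N : ℕ
  N = h ℕ.* d ℕ.* h

  ε>0 : 0ℚ < ε
  ε>0 = subst (_< ε) (+-inverseʳ t) (+-monoˡ-< (- t) t<h)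

  n : ℕ
  n = proj₁ (archimedean ε>0)

  -- so that suc k = suc N * suc n definitionally
  k : ℕ
  k = n ℕ.+ N ℕ.* suc n
  K : ℚ
  K = fromℕ (suc k)

  hdt≤N : fromℕ h * fromℕ d * t ≤ fromℕ N
  hdt≤N = begin
    fromℕ h * fromℕ d * t         ≤⟨ *-monoˡ-≤-nonNeg (fromℕ h * fromℕ d)
                                       {{nonNegative (nonNeg-* (fromℕ-nonNeg h) (fromℕ-nonNeg d))}} (<⇒≤ t<h) ⟩
    fromℕ h * fromℕ d * fromℕ h   ≡⟨ cong (_* fromℕ h) (×1-homo-* h d) ⟨
    fromℕ (h ℕ.* d) * fromℕ h     ≡⟨ ×1-homo-* (h ℕ.* d) h ⟨
    fromℕ N                       ∎

  1+N≤Kε : fromℕ (suc N) ≤ K * ε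
  1+N≤Kε = begin
    fromℕ (suc N)                          ≡⟨ *-identityʳ (fromℕ (suc N)) ⟨
    fromℕ (suc N) * 1ℚ                     ≤⟨ *-monoˡ-≤-nonNeg (fromℕ (suc N))
                                                {{nonNegative (fromℕ-nonNeg (suc N))}} (proj₂ (archimedean ε>0)) ⟩
    fromℕ (suc N) * (fromℕ (suc n) * ε)    ≡⟨ *-assoc (fromℕ (suc N)) (fromℕ (suc n)) ε ⟨
    fromℕ (suc N) * fromℕ (suc n) * ε      ≡⟨ cong (_* ε) (×1-homo-* (suc N) (suc n)) ⟨
    K * ε                                  ∎

  t+ε≡h : ∀ K t h → K * t + K * (h - t) ≡ K * h
  t+ε≡h = solve 3 (λ K t h → K :* t :+ K :* (h :- t) := K :* h) refl
    where open +-*-Solver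

FracColourable⇒bound : ∀ {h k t d} → FracColourable C⟨ h , suc k ⟩ t d →
                       fromℕ (suc k) * fromℕ h ≤ (fromℕ (suc k) + fromℕ h * fromℕ d) * t
FracColourable⇒bound {h} {k} {t} {d} (s , Y , α , α∈[0,1] , deg , ∑α≤t , covered)
  with ∃-light-branch d h Y α (proj₁ ∘ α∈[0,1]) deg
... | L , _ , |L|≡h , L-bound = begin
  K * fromℕ h                      ≡⟨ cong (λ m → K * fromℕ m) |L|≡h ⟨
  K * fromℕ (length L)             ≡⟨ cong (K *_) (trans (∑ₗ-const 1ℚ L) (*-identityʳ (fromℕ (length L)))) ⟨
  K * ∑ₗ (λ _ → 1ℚ) L              ≤⟨ *-monoˡ-≤-nonNeg K {{nonNegative (fromℕ-nonNeg (suc k))}}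
                                        (∑ₗ-mono-≤ (λ v → subst (1ℚ ≤_) (sumFin≡sum s _) (covered v)) L) ⟩
  K * ∑ₗ (coverage Y α) L          ≤⟨ L-bound ⟩
  (K + fromℕ h * fromℕ d) * sum α  ≤⟨ *-monoˡ-≤-nonNeg (K + fromℕ h * fromℕ d) {{nonNegative K+hd≥0}}
                                        (subst (_≤ t) (sumFin≡sum s α) ∑α≤t) ⟩
  (K + fromℕ h * fromℕ d) * t      ∎
  where
  open ≤-Reasoning
  K : ℚ
  K = fromℕ (suc k)
  K+hd≥0 : 0ℚ ≤ K + fromℕ h * fromℕ d
  K+hd≥0 = +-mono-≤ (fromℕ-nonNeg (suc k)) (nonNeg-* (fromℕ-nonNeg h) (fromℕ-nonNeg d))

lemma12 : (h : ℕ) (t : ℚ) → 0ℚ < t → t < (+ h) / 1 →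
    (d : ℕ) → ∃ λ k → ¬ FracColourable C⟨ h , k ⟩ t d
lemma12 h t _ t<h d =
  let k , gap = ∃-large-branching h d (subst (t <_) (sym (fromℕ≡/1 h)) t<h)
  in  suc k , λ colouring → <-irrefl refl (≤-<-trans (FracColourable⇒bound colouring) gap)
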